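{- If $G$ is a 2-connected graph that is not a triangle, then $G$ has four contractible edges, two of which do not share an endvertex.
   Context: All graphs are simple. An edge $e$ of a 2-connected graph $G$ is contractible if the (simple) graph $G/e$ is 2-connected. -}

module Defs where

open import Data.Nat using (ℕ)
open import Data.Fin using (Fin)
open import Data.Bool using (Bool; T)
open import Data.Unit using (⊤)
open import Data.Product using (Σ; _×_; _,_; ∃)
open import Data.Sum using (_⊎_)
open import Relation.Nullary using (¬_)
open import Relation.Binary.PropositionalEquality using (_≡_; _≢_)

record Graph (n : ℕ) : Set where
  field
    adj    : Fin n → Fin n → Bool
    sym    : ∀ x y → T (adj x y) → T (adj y x)
    irrefl : ∀ x → ¬ T (adj x x)

Adj : ∀ {n} → Graph n → Fin n → Fin n → Set
Adj G x y = T (Graph.adj G x y)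

-- A "graph with vertex set": vertices are the elements of Fin n satisfying S,
-- edges given by the relation A (only used between vertices in S).
-- Walks inside S along A.
data Walk {n : ℕ} (S : Fin n → Set) (A : Fin n → Fin n → Set) : Fin n → Fin n → Set where
  here : ∀ {x} → S x → Walk S A x x
  step : ∀ {x y z} → S x → A x y → Walk S A y z → Walk S A x z

Connected : ∀ {n} → (Fin n → Set) → (Fin n → Fin n → Set) → Set
Connected S A = ∀ x y → S x → S y → Walk S A x y

Remove : ∀ {n} → (Fin n → Set) → Fin n → (Fin n → Set)
Remove S w x = S x × x ≢ w

TwoConnected : ∀ {n} → (Fin n → Set) → (Fin n → Fin n → Set) → Set
TwoConnected S A =
  (Σ _ λ a → Σ _ λ b → Σ _ λ c → S a × S b × S c × a ≢ b × a ≢ c × b ≢ c)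
  × Connected S A
  × (∀ w → S w → Connected (Remove S w) A)

AllVertices : ∀ {n} → Fin n → Set
AllVertices _ = ⊤

TwoConnectedGraph : ∀ {n} → Graph n → Set
TwoConnectedGraph G = TwoConnected AllVertices (Adj G)

-- The (simple) graph G/e for the edge e = uv: v is deleted and u plays the
-- role of the merged vertex; x,y (distinct, ≠ v) are adjacent in G/e iff they
-- are adjacent in G, or one of them is u and the other is adjacent to v in G.
ContractVerts : ∀ {n} → Fin n → Fin n → Set
ContractVerts v x = x ≢ v

ContractAdj : ∀ {n} → Graph n → Fin n → Fin n → Fin n → Fin n → Set
ContractAdj G u v x y =
  x ≢ y × (Adj G x y ⊎ (x ≡ u × Adj G v y) ⊎ (y ≡ u × Adj G x v))

Contractible : ∀ {n} → Graph n → Fin n → Fin n → Set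
Contractible G u v = TwoConnected (ContractVerts v) (ContractAdj G u v)

IsTriangle : ∀ {n} → Graph n → Set
IsTriangle {n} G = n ≡ 3 × (∀ x y → x ≢ y → Adj G x y)

-- Edges given as (ordered) pairs of endpoints; two such denote the same edge
-- iff they agree as unordered pairs.
SameEdge : ∀ {n} → Fin n × Fin n → Fin n × Fin n → Set
SameEdge (a , b) (c , d) = (a ≡ c × b ≡ d) ⊎ (a ≡ d × b ≡ c)

Disjoint : ∀ {n} → Fin n × Fin n → Fin n × Fin n → Set
Disjoint (a , b) (c , d) = a ≢ c × a ≢ d × b ≢ c × b ≢ d

ContractibleEdge : ∀ {n} → Graph n → Fin n × Fin n → Set
ContractibleEdge G (u , v) = Adj G u v × Contractible G u v

-- Call an edge vy non-separating if G − v − y is connected. If G has at least four vertices,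
-- contracting a non-separating edge vy leaves a 2-connected graph: deleting the merged vertex
-- leaves G − v − y, and deleting any other vertex w leaves the image of G − w.
--
-- Every vertex v lies on two non-separating edges. Given an edge vx and a vertex d of G − v − x,
-- let y be the last vertex before v on a walk from d to v in G − x. If vy is separating, some
-- component of G − v − y avoids x; it lies inside the component of d in G − v − x and misses y,
-- so induction on that component gives a non-separating edge vz with z reachable from d in
-- G − v − x. Applying this to d and to a vertex in another component of G − v − x (or taking vx
-- itself when G − v − x is connected) gives two distinct such edges at v.
--
-- A 2-connected graph on three vertices is a triangle, so G has at least four vertices. Take the
-- two edges pa, pb at a vertex p and the two at a vertex w ∉ {p, a, b}: these are four distinct
-- contractible edges, and one of pa, pb is disjoint from one of the edges at w.

module Submission where

open import Defs
open import Data.Nat using (ℕ; _≤_; _<_; s≤s; z≤n)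
open import Data.Nat.Properties using (<⇒≱; ≤-refl; ≤-trans; 1+n≰n; m≤n⇒m<n∨m≡n)
open import Data.Fin using (Fin; _≟_)
open import Data.Fin.Properties using (any?; injective⇒≤)
open import Data.Fin.Subset using (Subset; _∈_; _⊂_; _-_; ⁅_⁆)
open import Data.Fin.Subset.Properties using (_∈?_; p─q⊆p; x∈p∧x≢y⇒x∈p-y; x∈p⇒p-x⊂p)
open import Data.Fin.Subset.Induction using (⊂-wellFounded)
open import Data.Empty using (⊥-elim)
open import Data.Product using (Σ; ∃; ∃₂; _×_; _,_; proj₁; proj₂)
open import Data.Sum using (_⊎_; inj₁; inj₂)
open import Data.List using (List; []; _∷_; length; lookup)
open import Data.List.Membership.Propositional using () renaming (_∈_ to _∈ₗ_)
open import Data.List.Relation.Unary.All using (All; []; _∷_)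
open import Data.List.Relation.Unary.All.Properties using (¬Any⇒All¬)
import Data.List.Relation.Unary.Any as Any
open import Data.List.Relation.Unary.Any.Properties using (lookup-index)
open import Data.Vec as Vec using (Vec; tabulate)
open import Data.Vec.Properties using (lookup∘tabulate; []=⇒lookup; lookup⇒[]=)
open import Data.Vec.Relation.Unary.AllPairs using ([]; _∷_)
open import Data.Vec.Relation.Unary.All using ([]; _∷_)
open import Data.Vec.Relation.Unary.Unique.Propositional using (Unique)
open import Data.Vec.Relation.Unary.Unique.Propositional.Properties using (lookup-injective)
open import Function using (_∘_; id; Injective)
open import Induction.WellFounded using (Acc; acc)
open import Relation.Binary.Definitions using (Symmetric; Decidable)
open import Relation.Binary.PropositionalEquality using (_≡_; _≢_; refl; sym; trans; cong; subst; subst₂)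
open import Relation.Nullary using (¬_; Dec; yes; no; does; proof; contradiction)
open import Relation.Nullary.Reflects using (Reflects; invert)
open import Relation.Nullary.Decidable using (map′; _×-dec_; _⊎-dec_; ¬?; T?; dec-true; decidable-stable)
import Relation.Unary as U

private
  variable
    n : ℕ
    S S′ : Fin n → Set
    A A′ : Fin n → Fin n → Set

source : ∀ {x y} → Walk S A x y → S x
source (here s)     = s
source (step s _ _) = s

target : ∀ {x y} → Walk S A x y → S y
target (here s)     = s
target (step _ _ w) = target w

infixr 5 _++_
_++_ : ∀ {x y z} → Walk S A x y → Walk S A y z → Walk S A x z
here _     ++ w′ = w′
step s a w ++ w′ = step s a (w ++ w′)

snoc : ∀ {x y z} → Walk S A x y → A y z → S z → Walk S A x z
snoc w a s = w ++ step (target w) a (here s)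

reverse : Symmetric A → ∀ {x y} → Walk S A x y → Walk S A y x
reverse A-sym (here s)     = here s
reverse A-sym (step s a w) = snoc (reverse A-sym w) (A-sym a) s

avoid-or-reach : ∀ z {x y} → Walk S A x y → Walk (Remove S z) A x y ⊎ Walk S A x z
avoid-or-reach z {x} (here s) with x ≟ z
... | yes refl = inj₂ (here s)
... | no x≢z   = inj₁ (here (s , x≢z))
avoid-or-reach z {x} (step s a w) with x ≟ z | avoid-or-reach z w
... | yes refl | _       = inj₂ (here s)
... | no x≢z   | inj₁ w′ = inj₁ (step (s , x≢z) a w′)
... | no _     | inj₂ w′ = inj₂ (step s a w′)

avoid-or-leave : ∀ z {x y} → y ≢ z → Walk S A x y →
  Walk (Remove S z) A x y ⊎ ∃ λ z′ → A z z′ × Walk (Remove S z) A z′ y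
avoid-or-leave z y≢z (here s) = inj₁ (here (s , y≢z))
avoid-or-leave z {x} y≢z (step s a w) with avoid-or-leave z y≢z w
... | inj₂ leaving = inj₂ leaving
... | inj₁ w′ with x ≟ z
...   | yes refl = inj₂ (_ , a , w′)
...   | no x≢z   = inj₁ (step (s , x≢z) a w′)

leave : ∀ {x y} → Walk S A x y → x ≢ y → ∃ λ x′ → A x x′ × Walk (Remove S x) A x′ y
leave w x≢y with avoid-or-leave _ (x≢y ∘ sym) w
... | inj₁ w′     = ⊥-elim (proj₂ (source w′) refl)
... | inj₂ leaving = leaving

first-entry : {Q : Fin n → Set} → U.Decidable Q → ∀ {x y} → Walk S A x y → ¬ Q x → Q y →
  ∃₂ λ t′ t → Walk (λ u → S u × ¬ Q u) A x t′ × A t′ t × Q t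
first-entry Q? (here _) ¬qx qy = ⊥-elim (¬qx qy)
first-entry Q? (step {y = x′} s a w) ¬qx qy with Q? x′
... | yes qx′ = _ , x′ , here (s , ¬qx) , a , qx′
... | no ¬qx′ with first-entry Q? w ¬qx′ qy
...   | t′ , t , w′ , a′ , qt = t′ , t , step (s , ¬qx) a w′ , a′ , qt

map : (∀ {z} → S z → S′ z) → (∀ {a b} → A a b → A′ a b) → ∀ {x y} → Walk S A x y → Walk S′ A′ x y
map f g (here s)     = here (f s)
map f g (step s a w) = step (f s) (g a) (map f g w)

image : (f : Fin n → Fin n) →
  (∀ {z} → S z → S′ (f z)) → (∀ {a b} → A a b → f a ≡ f b ⊎ A′ (f a) (f b)) →
  ∀ {x y} → Walk S A x y → Walk S′ A′ (f x) (f y)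
image f fS fA (here s) = here (fS s)
image {S′ = S′} {A′ = A′} f fS fA (step {z = z} s a w) with fA a
... | inj₁ fx≡fy = subst (λ u → Walk S′ A′ u (f z)) (sym fx≡fy) (image f fS fA w)
... | inj₂ a′    = step (fS s) a′ (image f fS fA w)

module _ {P : Fin n → Set} (P? : U.Decidable P) where

  toSubset : Subset n
  toSubset = tabulate (does ∘ P?)

  ∈-toSubset⁺ : ∀ {x} → P x → x ∈ toSubset
  ∈-toSubset⁺ {x} px = lookup⇒[]= x toSubset (trans (lookup∘tabulate _ x) (dec-true (P? x) px))

  ∈-toSubset⁻ : ∀ {x} → x ∈ toSubset → P x
  ∈-toSubset⁻ {x} x∈ =
    invert (subst (Reflects (P x)) (trans (sym (lookup∘tabulate _ x)) ([]=⇒lookup x∈)) (proof (P? x)))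

module _ {A : Fin n → Fin n → Set} (A? : Decidable A) where

  private
    -- Recursing on p - x is complete because a walk from x can be cut so that it leaves x once
    -- and never returns.
    walk∈? : (p : Subset n) → Acc _⊂_ p → ∀ x y → Dec (Walk (_∈ p) A x y)
    walk∈? p (acc smaller) x y with x ∈? p | x ≟ y
    ... | no x∉p  | _        = no (x∉p ∘ source)
    ... | yes x∈p | yes refl = yes (here x∈p)
    ... | yes x∈p | no x≢y   =
      map′ (λ (x′ , a , w) → step x∈p a (map (p─q⊆p p ⁅ x ⁆) id w))
           (λ w → let x′ , a , w′ = leave w x≢y
                  in x′ , a , map (λ (z∈p , z≢x) → x∈p∧x≢y⇒x∈p-y z∈p z≢x) id w′)
           (any? λ x′ → A? x x′ ×-dec walk∈? (p - x) (smaller (x∈p⇒p-x⊂p x∈p)) x′ y)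

  walk? : U.Decidable S → ∀ x y → Dec (Walk S A x y)
  walk? S? x y =
    map′ (map (∈-toSubset⁻ S?) id) (map (∈-toSubset⁺ S?) id) (walk∈? (toSubset S?) (⊂-wellFounded _) x y)

  connected-or-unreachable : U.Decidable S → Symmetric A → ∀ {x} → S x →
    Connected S A ⊎ ∃ λ c → S c × ¬ Walk S A x c
  connected-or-unreachable {S = S} S? A-sym {x} x∈S with any? (λ c → S? c ×-dec ¬? (walk? S? x c))
  ... | yes unreachable = inj₂ unreachable
  ... | no none         = inj₁ λ a b a∈S b∈S → reverse A-sym (reach a∈S) ++ reach b∈S
    where
    reach : ∀ {c} → S c → Walk S A x c
    reach {c} c∈S = decidable-stable (walk? S? x c) (λ x̸⇝c → none (c , c∈S , x̸⇝c))

-- If every vertex occurred in ys, positions in ys would inject Fin n into Fin (length ys).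
fresh : (ys : List (Fin n)) → length ys < n → ∃ λ x → All (x ≢_) ys
fresh {n} ys |ys|<n with any? (λ x → ¬? (Any.any? (x ≟_) ys))
... | yes (x , x∉ys) = x , ¬Any⇒All¬ ys x∉ys
... | no none        = contradiction (injective⇒≤ index-injective) (<⇒≱ |ys|<n)
  where
  covered : ∀ x → x ∈ₗ ys
  covered x = decidable-stable (Any.any? (x ≟_) ys) (λ x∉ys → none (x , x∉ys))

  index-injective : Injective _≡_ _≡_ (λ x → Any.index (covered x))
  index-injective {x} {y} eq =
    trans (lookup-index (covered x)) (trans (cong (lookup ys) eq) (sym (lookup-index (covered y))))

distinct⇒≤ : ∀ {k} {xs : Vec (Fin n) k} → Unique xs → k ≤ n
distinct⇒≤ {xs = xs} u = injective⇒≤ {f = Vec.lookup xs} (λ {i} {j} → lookup-injective u i j)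

module _ (G : Graph n) where

  adj⇒≢ : ∀ {x y} → Adj G x y → x ≢ y
  adj⇒≢ {x} e refl = Graph.irrefl G x e

  adj? : Decidable (Adj G)
  adj? x y = T? (Graph.adj G x y)

  adj-sym : Symmetric (Adj G)
  adj-sym = Graph.sym G _ _

  connected-∖ : TwoConnectedGraph G → ∀ w → Connected (_≢ w) (Adj G)
  connected-∖ (_ , _ , no-cut-vertex) w x y x≢w y≢w =
    map proj₂ id (no-cut-vertex w _ x y (_ , x≢w) (_ , y≢w))

  twoConnected⇒3≤n : TwoConnectedGraph G → 3 ≤ n
  twoConnected⇒3≤n ((a , b , c , _ , _ , _ , a≢b , a≢c , b≢c) , _) =
    distinct⇒≤ ((a≢b ∷ a≢c ∷ []) ∷ (b≢c ∷ []) ∷ [] ∷ [])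

twoConnected-order3⇒complete : (G : Graph 3) → TwoConnectedGraph G → ∀ x y → x ≢ y → Adj G x y
twoConnected-order3⇒complete G tc x y x≢y
  with w , w≢x ∷ w≢y ∷ [] ← fresh (x ∷ y ∷ []) ≤-refl
  with x′ , xx′ , x′⇝y ← leave (connected-∖ G tc w x y (w≢x ∘ sym) (w≢y ∘ sym)) x≢y
  with x′≢w , x′≢x ← source x′⇝y
  with x′ ≟ y
... | yes refl = xx′
... | no x′≢y  = ⊥-elim (1+n≰n (distinct⇒≤ four-distinct))
  where
  four-distinct : Unique (x Vec.∷ y Vec.∷ w Vec.∷ x′ Vec.∷ Vec.[])
  four-distinct = (x≢y ∷ (w≢x ∘ sym) ∷ (x′≢x ∘ sym) ∷ [])
                ∷ ((w≢y ∘ sym) ∷ (x′≢y ∘ sym) ∷ [])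
                ∷ ((x′≢w ∘ sym) ∷ [])
                ∷ [] ∷ []

twoConnected∧¬triangle⇒4≤n : (G : Graph n) → TwoConnectedGraph G → ¬ IsTriangle G → 4 ≤ n
twoConnected∧¬triangle⇒4≤n G tc not-triangle with m≤n⇒m<n∨m≡n (twoConnected⇒3≤n G tc)
... | inj₁ 3<n = 3<n
... | inj₂ refl = ⊥-elim (not-triangle (refl , twoConnected-order3⇒complete G tc))

FourEdgesTwoDisjoint : (Fin n × Fin n → Set) → Set
FourEdgesTwoDisjoint {n} P =
  Σ (Fin n × Fin n) λ e₁ → Σ (Fin n × Fin n) λ e₂ →
  Σ (Fin n × Fin n) λ e₃ → Σ (Fin n × Fin n) λ e₄ →
    P e₁ × P e₂ × P e₃ × P e₄ ×
    ¬ SameEdge e₁ e₂ × ¬ SameEdge e₁ e₃ × ¬ SameEdge e₁ e₄ ×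
    ¬ SameEdge e₂ e₃ × ¬ SameEdge e₂ e₄ × ¬ SameEdge e₃ e₄ ×
    Disjoint e₁ e₂

¬SameEdge-fst : ∀ {u v u′ v′ : Fin n} → u ≢ u′ → v ≢ u′ → ¬ SameEdge (u , v) (u′ , v′)
¬SameEdge-fst u≢u′ _    (inj₁ (u≡u′ , _)) = u≢u′ u≡u′
¬SameEdge-fst _    v≢u′ (inj₂ (_ , v≡u′)) = v≢u′ v≡u′

¬SameEdge-snd : ∀ {u v u′ v′ : Fin n} → u ≢ v′ → v ≢ v′ → ¬ SameEdge (u , v) (u′ , v′)
¬SameEdge-snd _    v≢v′ (inj₁ (_ , v≡v′)) = v≢v′ v≡v′
¬SameEdge-snd u≢v′ _    (inj₂ (u≡v′ , _)) = u≢v′ u≡v′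

module _ (P : Fin n × Fin n → Set) (P⇒≢ : ∀ {u v} → P (u , v) → u ≢ v) {p w : Fin n} (w≢p : w ≢ p) where

  -- (w , c) and (p , a) are disjoint once c ∉ {p , a}; the wrappers swap c with e and a with b
  -- to arrange this.
  private
    stars-c∉pa : ∀ {a b c e} → a ≢ b → c ≢ e → w ≢ a → w ≢ b → c ≢ p → c ≢ a →
      P (p , a) → P (p , b) → P (w , c) → P (w , e) → FourEdgesTwoDisjoint P
    stars-c∉pa a≢b c≢e w≢a w≢b c≢p c≢a pa pb wc we =
      (w , _) , (p , _) , (p , _) , (w , _) , wc , pa , pb , we ,
      ¬SameEdge-fst w≢p c≢p , ¬SameEdge-fst w≢p c≢p , ¬SameEdge-snd (P⇒≢ we) c≢e ,
      ¬SameEdge-snd (P⇒≢ pb) a≢b , ¬SameEdge-fst (w≢p ∘ sym) (w≢a ∘ sym) ,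
      ¬SameEdge-fst (w≢p ∘ sym) (w≢b ∘ sym) ,
      w≢p , w≢a , c≢p , c≢a

    stars-c≢p : ∀ {a b c e} → a ≢ b → c ≢ e → w ≢ a → w ≢ b → c ≢ p →
      P (p , a) → P (p , b) → P (w , c) → P (w , e) → FourEdgesTwoDisjoint P
    stars-c≢p {a} {c = c} a≢b c≢e w≢a w≢b c≢p pa pb wc we with c ≟ a
    ... | yes c≡a = stars-c∉pa (a≢b ∘ sym) c≢e w≢b w≢a c≢p (a≢b ∘ trans (sym c≡a)) pb pa wc we
    ... | no c≢a  = stars-c∉pa a≢b c≢e w≢a w≢b c≢p c≢a pa pb wc we

  two-stars : ∀ {a b c e} → a ≢ b → c ≢ e → w ≢ a → w ≢ b →
    P (p , a) → P (p , b) → P (w , c) → P (w , e) → FourEdgesTwoDisjoint P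
  two-stars {c = c} a≢b c≢e w≢a w≢b pa pb wc we with c ≟ p
  ... | yes c≡p = stars-c≢p a≢b (c≢e ∘ sym) w≢a w≢b (c≢e ∘ trans c≡p ∘ sym) pa pb we wc
  ... | no c≢p  = stars-c≢p a≢b c≢e w≢a w≢b c≢p pa pb wc we

module NonSeparatingEdges {n : ℕ} (G : Graph n) (tc : TwoConnectedGraph G) (4≤n : 4 ≤ n) where

  private
    E : Fin n → Fin n → Set
    E = Adj G

    G-connected : Connected AllVertices E
    G-connected = proj₁ (proj₂ tc)

  Without : Fin n → Fin n → Fin n → Set
  Without x v = Remove (_≢ x) v

  without? : ∀ x v → U.Decidable (Without x v)
  without? x v z = ¬? (z ≟ x) ×-dec ¬? (z ≟ v)

  NonSeparating : Fin n → Fin n → Set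
  NonSeparating v y = E v y × Connected (Without y v) E

  -- The component of d in G − x − v, as a finite subset so that ⊂ is well-founded on it.
  component : Fin n → Fin n → Fin n → Subset n
  component x v d = toSubset (walk? (adj? G) (without? x v) d)

  ∈-component⁺ : ∀ {x v d z} → Walk (Without x v) E d z → z ∈ component x v d
  ∈-component⁺ {x} {v} {d} = ∈-toSubset⁺ (walk? (adj? G) (without? x v) d)

  ∈-component⁻ : ∀ {x v d z} → z ∈ component x v d → Walk (Without x v) E d z
  ∈-component⁻ {x} {v} {d} = ∈-toSubset⁻ (walk? (adj? G) (without? x v) d)

  fresh₃ : (ys : List (Fin n)) → length ys ≤ 3 → ∃ λ x → All (x ≢_) ys
  fresh₃ ys |ys|≤3 = fresh ys (≤-trans (s≤s |ys|≤3) 4≤n)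

  module _ {v x d y : Fin n} (vx : E v x) (d⇝y : Walk (Without x v) E d y) where

    x∈Without-y-v : Without y v x
    x∈Without-y-v = proj₁ (target d⇝y) ∘ sym , adj⇒≢ G vx ∘ sym

    -- If c cannot reach x in G − y − v, then a walk from c to x in G − v meets y before x,
    -- so the component of c in G − y − v lies inside the component of d in G − x − v.
    module _ {c : Fin n} (c∈ : Without y v c) (x̸⇝c : ¬ Walk (Without y v) E x c) where

      private
        d⇝c : Walk (Without x v) E d c
        d⇝c with first-entry (λ u → (u ≟ x) ⊎-dec (u ≟ y))
                   (connected-∖ G tc v c x (proj₂ c∈) (proj₂ x∈Without-y-v))
                   (λ { (inj₁ refl) → x̸⇝c (here x∈Without-y-v) ; (inj₂ refl) → proj₁ c∈ refl })
                   (inj₁ refl)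
        ... | _ , _ , c⇝t′ , t′x , inj₁ refl =
              ⊥-elim (x̸⇝c (reverse (adj-sym G)
                (snoc (map (λ (z≢v , z∉) → z∉ ∘ inj₂ , z≢v) id c⇝t′) t′x x∈Without-y-v)))
        ... | _ , _ , c⇝t′ , t′y , inj₂ refl =
              d⇝y ++ reverse (adj-sym G)
                (snoc (map (λ (z≢v , z∉) → z∉ ∘ inj₁ , z≢v) id c⇝t′) t′y (target d⇝y))

      reroute : ∀ {z} → Walk (Without y v) E c z → Walk (Without x v) E d z
      reroute c⇝z with avoid-or-reach x c⇝z
      ... | inj₁ c⇝z′ = d⇝c ++ map (λ ((_ , z≢v) , z≢x) → z≢x , z≢v) id c⇝z′
      ... | inj₂ c⇝x  = ⊥-elim (x̸⇝c (reverse (adj-sym G) c⇝x))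

      component-shrinks : component y v c ⊂ component x v d
      component-shrinks =
        (λ z∈ → ∈-component⁺ (reroute (∈-component⁻ {y} {v} {c} z∈))) ,
        y , ∈-component⁺ d⇝y , λ y∈ → proj₁ (target (∈-component⁻ {y} {v} {c} y∈)) refl

  nonSeparating-reachable : ∀ {v x d} → E v x → Without x v d → Acc _⊂_ (component x v d) →
    ∃ λ y → Walk (Without x v) E d y × NonSeparating v y
  nonSeparating-reachable {v} {x} {d} vx (d≢x , d≢v) (acc smaller)
    with y , _ , d⇝y , yv , refl ←
           first-entry (_≟ v) (connected-∖ G tc x d v d≢x (adj⇒≢ G vx)) d≢v refl
    with connected-or-unreachable (adj? G) (without? y v) (adj-sym G) (x∈Without-y-v vx d⇝y)
  ... | inj₁ y-v-connected = y , d⇝y , adj-sym G yv , y-v-connected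
  ... | inj₂ (c , c∈ , x̸⇝c)
    with z , c⇝z , vz ←
           nonSeparating-reachable (adj-sym G yv) c∈ (smaller (component-shrinks vx d⇝y c∈ x̸⇝c))
    = z , reroute vx d⇝y c∈ x̸⇝c c⇝z , vz

  nonSeparating-near : ∀ {v x d} → E v x → Without x v d →
    ∃ λ y → Walk (Without x v) E d y × NonSeparating v y
  nonSeparating-near vx d∈ = nonSeparating-reachable vx d∈ (⊂-wellFounded _)

  two-nonSeparating : ∀ v → ∃₂ λ a b → a ≢ b × NonSeparating v a × NonSeparating v b
  two-nonSeparating v
    with z , z≢v ∷ [] ← fresh₃ (v ∷ []) (s≤s z≤n)
    with x , vx , _ ← leave (G-connected v z _ _) (z≢v ∘ sym)
    with d , d≢x ∷ d≢v ∷ [] ← fresh₃ (x ∷ v ∷ []) (s≤s (s≤s z≤n))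
    with connected-or-unreachable (adj? G) (without? x v) (adj-sym G) (d≢x , d≢v)
  ... | inj₁ x-v-connected
    with y , d⇝y , vy ← nonSeparating-near vx (d≢x , d≢v)
    = x , y , proj₁ (target d⇝y) ∘ sym , (vx , x-v-connected) , vy
  ... | inj₂ (c , c∈ , d̸⇝c)
    with y₁ , d⇝y₁ , vy₁ ← nonSeparating-near vx (d≢x , d≢v)
    with y₂ , c⇝y₂ , vy₂ ← nonSeparating-near vx c∈
    = y₁ , y₂ , (λ { refl → d̸⇝c (d⇝y₁ ++ reverse (adj-sym G) c⇝y₂) }) , vy₁ , vy₂

  module _ {p q : Fin n} where

    adj⇒contractAdj : ∀ {a b} → E a b → ContractAdj G p q a b
    adj⇒contractAdj ab = adj⇒≢ G ab , inj₁ ab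

    private
      merge : Fin n → Fin n
      merge z with z ≟ q
      ... | yes _ = p
      ... | no _  = z

      merge-fixed : ∀ {z} → z ≢ q → merge z ≡ z
      merge-fixed {z} z≢q with z ≟ q
      ... | yes z≡q = ⊥-elim (z≢q z≡q)
      ... | no _    = refl

      merge-edge : ∀ {a b} → E a b → merge a ≡ merge b ⊎ ContractAdj G p q (merge a) (merge b)
      merge-edge {a} {b} ab with a ≟ q | b ≟ q
      ... | yes refl | yes refl = ⊥-elim (adj⇒≢ G ab refl)
      ... | yes refl | no _ with p ≟ b
      ...   | yes p≡b = inj₁ p≡b
      ...   | no p≢b  = inj₂ (p≢b , inj₂ (inj₁ (refl , ab)))
      merge-edge {a} {b} ab | no _ | yes refl with a ≟ p
      ...   | yes a≡p = inj₁ a≡p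
      ...   | no a≢p  = inj₂ (a≢p , inj₂ (inj₂ (refl , ab)))
      merge-edge {a} {b} ab | no _ | no _ = inj₂ (adj⇒contractAdj ab)

    contraction-connected : Connected (ContractVerts q) (ContractAdj G p q)
    contraction-connected x y x≢q y≢q =
      map id adj⇒contractAdj (connected-∖ G tc q x y x≢q y≢q)

    contraction-connected-∖ : ∀ {w} → E p q → w ≢ p →
      Connected (Remove (ContractVerts q) w) (ContractAdj G p q)
    contraction-connected-∖ {w} pq w≢p x y (x≢q , x≢w) (y≢q , y≢w) =
      subst₂ (Walk _ _) (merge-fixed x≢q) (merge-fixed y≢q)
        (image merge merge-avoids merge-edge (connected-∖ G tc w x y x≢w y≢w))
      where
      merge-avoids : ∀ {z} → z ≢ w → merge z ≢ q × merge z ≢ w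
      merge-avoids {z} z≢w with z ≟ q
      ... | yes _  = adj⇒≢ G pq , w≢p ∘ sym
      ... | no z≢q = z≢q , z≢w

  nonSeparating⇒contractible : ∀ {p q} → NonSeparating p q → ContractibleEdge G (p , q)
  nonSeparating⇒contractible {p} {q} (pq , q-p-connected)
    with z₁ , z₁≢q ∷ [] ← fresh₃ (q ∷ []) (s≤s z≤n)
    with z₂ , z₂≢q ∷ z₂≢z₁ ∷ [] ← fresh₃ (q ∷ z₁ ∷ []) (s≤s (s≤s z≤n))
    with z₃ , z₃≢q ∷ z₃≢z₁ ∷ z₃≢z₂ ∷ [] ← fresh₃ (q ∷ z₁ ∷ z₂ ∷ []) ≤-refl
    = pq , (z₁ , z₂ , z₃ , z₁≢q , z₂≢q , z₃≢q , z₂≢z₁ ∘ sym , z₃≢z₁ ∘ sym , z₃≢z₂ ∘ sym)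
         , contraction-connected , deletion-connected
    where
    deletion-connected : ∀ w → ContractVerts q w →
      Connected (Remove (ContractVerts q) w) (ContractAdj G p q)
    deletion-connected w _ with w ≟ p
    ... | yes refl = λ x y x∈ y∈ → map id adj⇒contractAdj (q-p-connected x y x∈ y∈)
    ... | no w≢p   = contraction-connected-∖ pq w≢p

  four-contractible-edges : FourEdgesTwoDisjoint (ContractibleEdge G)
  four-contractible-edges
    with p , [] ← fresh₃ [] z≤n
    with a , b , a≢b , pa , pb ← two-nonSeparating p
    with w , w≢p ∷ w≢a ∷ w≢b ∷ [] ← fresh₃ (p ∷ a ∷ b ∷ []) ≤-refl
    with c , e , c≢e , wc , we ← two-nonSeparating w
    = two-stars (ContractibleEdge G) (adj⇒≢ G ∘ proj₁) w≢p a≢b c≢e w≢a w≢b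
        (nonSeparating⇒contractible pa) (nonSeparating⇒contractible pb)
        (nonSeparating⇒contractible wc) (nonSeparating⇒contractible we)

lemma4p5 : (n : ℕ) (G : Graph n) → TwoConnectedGraph G → ¬ IsTriangle G →
    Σ (Fin n × Fin n) λ e₁ → Σ (Fin n × Fin n) λ e₂ →
    Σ (Fin n × Fin n) λ e₃ → Σ (Fin n × Fin n) λ e₄ →
      ContractibleEdge G e₁ × ContractibleEdge G e₂ ×
      ContractibleEdge G e₃ × ContractibleEdge G e₄ ×
      ¬ SameEdge e₁ e₂ × ¬ SameEdge e₁ e₃ × ¬ SameEdge e₁ e₄ ×
      ¬ SameEdge e₂ e₃ × ¬ SameEdge e₂ e₄ × ¬ SameEdge e₃ e₄ ×
      Disjoint e₁ e₂
lemma4p5 n G tc not-triangle =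
  NonSeparatingEdges.four-contractible-edges G tc (twoConnected∧¬triangle⇒4≤n G tc not-triangle)
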